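{- Let $\{a_1,\ldots,a_m\}$ and $\{b_1,\ldots,b_m\}$ be multisets of positive integers and write \[ f(q)=\frac{\prod_{k=1}^m[a_k]_q}{\prod_{k=1}^m[b_k]_q}=\sum_{k\ge0}c_kq^k\in\mathbb{Z}[[q]]. \] Set $M_i:=\#\{k:b_k=i\}-\#\{k:a_k=i\}$ for $i\ge1$. Then for every $k\ge0$, \[ c_k=\sum_{|\mu|=k}\ \prod_{i\ge1,\ m_i(\mu)>0}\binom{M_i+m_i(\mu)-1}{m_i(\mu)}, \] where the sum is over integer partitions $\mu$ of $k$ and $m_i(\mu)$ is the number of parts of $\mu$ equal to $i$; in particular $c_k$ is a polynomial in $M_1,\ldots,M_k$. Moreover the sum may be restricted to those partitions $\mu$ of $k$ such that for every $i\ge1$, either $M_i>0$ or $m_i(\mu)\le|M_i|$.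
   Context: $[n]_q=1+q+\cdots+q^{n-1}$. For $x\in\mathbb{Z}$ (possibly negative) and $k\in\mathbb{Z}_{\ge0}$, $\binom{x}{k}:=x(x-1)\cdots(x-k+1)/k!$, with $\binom{x}{0}=1$. -}

module Defs where

open import Data.Nat as ℕ using (ℕ; zero; suc; _≤ᵇ_; _≡ᵇ_)
open import Data.Nat.Properties using (_!≢0)
open import Data.Nat.Combinatorics using ()
open import Data.Nat.Base using (_!)
open import Data.Integer as ℤ using (ℤ; +_; _+_; _-_; _*_; ∣_∣)
open import Data.Integer.DivMod using (_/ℕ_)
open import Data.List using (List; []; _∷_; foldr; map; filter; length; concatMap; upTo; applyUpTo)
open import Data.Bool using (Bool; true; false; if_then_else_; _∧_; _∨_)
open import Relation.Nullary.Decidable using (does)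

Series : Set
Series = ℕ → ℤ

Σℤ : ℕ → (ℕ → ℤ) → ℤ
Σℤ zero    f = + 0
Σℤ (suc n) f = Σℤ n f + f n

_⋆_ : Series → Series → Series
(f ⋆ g) n = Σℤ (suc n) (λ i → f i * g (n ℕ.∸ i))

oneS : Series
oneS zero    = + 1
oneS (suc _) = + 0

-- [n]_q = 1 + q + ... + q^{n-1}
qint : ℕ → Series
qint n k = if suc k ≤ᵇ n then + 1 else + 0

prodQ : List ℕ → Series
prodQ = foldr (λ x s → qint x ⋆ s) oneS

fallingℤ : ℤ → ℕ → ℤ
fallingℤ x zero    = + 1
fallingℤ x (suc k) = fallingℤ x k * (x - + k)

binomℤ : ℤ → ℕ → ℤ
binomℤ x k = _/ℕ_ (fallingℤ x k) (k !) {{k !≢0}}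

count : ℕ → List ℕ → ℕ
count i xs = length (filter (λ x → x ℕ.≟ i) xs)

Mult : List ℕ → List ℕ → ℕ → ℤ
Mult a b i = + count i b - + count i a

-- Integer partitions of k: nonincreasing lists of positive integers
-- summing to k.  Enumerated by filtering all lists of length ≤ k with
-- entries in {1,…,k}.

listsOf : ℕ → ℕ → List (List ℕ)
listsOf k zero    = [] ∷ []
listsOf k (suc l) = concatMap (λ x → map (x ∷_) (listsOf k l)) (applyUpTo suc k)

nonincreasingᵇ : List ℕ → Bool
nonincreasingᵇ []           = true
nonincreasingᵇ (x ∷ [])     = true
nonincreasingᵇ (x ∷ y ∷ xs) = (y ≤ᵇ x) ∧ nonincreasingᵇ (y ∷ xs)

sumℕ : List ℕ → ℕ
sumℕ = foldr ℕ._+_ 0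

isPartitionᵇ : ℕ → List ℕ → Bool
isPartitionᵇ k μ = nonincreasingᵇ μ ∧ (sumℕ μ ≡ᵇ k)

partitions : ℕ → List (List ℕ)
partitions k =
  filter (λ μ → Data.Bool._≟_ (isPartitionᵇ k μ) true)
         (concatMap (listsOf k) (upTo (suc k)))
  where import Data.Bool

sumListℤ : List ℤ → ℤ
sumListℤ = foldr _+_ (+ 0)

prodListℤ : List ℤ → ℤ
prodListℤ = foldr _*_ (+ 1)

-- ∏_{i ≥ 1, m_i(μ) > 0} binom(M_i + m_i(μ) - 1, m_i(μ)), where parts of a
-- partition of k are ≤ k, so i ranges over 1..k.
term : (ℕ → ℤ) → ℕ → List ℕ → ℤ
term M k μ =
  prodListℤ (map (λ i → if 1 ≤ᵇ count i μ
                        then binomℤ (M i + + count i μ - + 1) (count i μ)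
                        else + 1)
                 (applyUpTo suc k))

-- restriction: for every i ≥ 1, M_i > 0 or m_i(μ) ≤ |M_i|
-- (for i > k, m_i(μ) = 0 so the condition holds automatically)
admissibleᵇ : (ℕ → ℤ) → ℕ → List ℕ → Bool
admissibleᵇ M k μ =
  foldr _∧_ true (map (λ i → does (+ 0 ℤ.<? M i) ∨ (count i μ ≤ᵇ ∣ M i ∣))
                      (applyUpTo suc k))

fullSum : (ℕ → ℤ) → ℕ → ℤ
fullSum M k = sumListℤ (map (term M k) (partitions k))

restrictedSum : (ℕ → ℤ) → ℕ → ℤ
restrictedSum M k =
  sumListℤ (map (term M k)
                (filter (λ μ → Data.Bool._≟_ (admissibleᵇ M k μ) true) (partitions k)))
  where import Data.Bool

-- Multiplying numerator and denominator by (1 - q)^m turns f into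
-- ∏ (1 - q^a_k) / ∏ (1 - q^b_k) = ∏_{i ≥ 1} (1 - q^i)^(-M_i), a quotient of series with constant
-- term 1, so c is the unique solution of c · ∏ (1 - q^b_k) = ∏ (1 - q^a_k). The product is
-- assembled one factor at a time, each step being Pascal's rule in the form
-- (1 - q^i) (1 - q^i)^(-(M+1)) = (1 - q^i)^(-M). By the negative binomial theorem
-- (1 - q^i)^(-M) = Σ_m binom(M+m-1, m) q^(i m), so the coefficient of q^k is a sum over the ways
-- of writing k = Σ_i i m_i, i.e. over the partitions of k. The restriction only drops zero
-- terms: if M_i ≤ 0 then binom(M_i + m - 1, m) = 0 for m > |M_i|.
module Submission where

open import Defs
open import Algebra.Bundles using (AbelianGroup; CommutativeMonoid)
open import Data.Bool as Bool using (true; false; T; T?; if_then_else_; _∨_)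
open import Data.Bool.Properties using (T-∧; T-∨; T-≡)
open import Data.Integer as ℤ using (ℤ; +_; -[1+_]; _+_; _-_; _*_; -_; _^_; -1ℤ; ∣_∣)
open import Data.Integer.DivMod using (_/ℕ_)
import Data.Integer.Properties as ℤP
open import Data.Integer.Tactic.RingSolver using (solve-∀)
open import Data.List using (List; []; _∷_; _++_; length; foldr; map; concatMap; replicate; upTo; applyUpTo; filter)
open import Data.List.Membership.Propositional using (_∈_)
open import Data.List.Membership.Propositional.Properties
  using (∈-concat⁺′; ∈-concat⁻′; ∈-map⁺; ∈-map⁻; ∈-upTo⁺; ∈-upTo⁻; ∈-applyUpTo⁺; ∈-applyUpTo⁻; ∈-filter⁺; ∈-filter⁻)
open import Data.List.Membership.Propositional.Properties.WithK using (unique∧set⇒bag)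
open import Data.List.Properties using (map-∘; map-++; filter-accept; filter-reject; ∷-injectiveˡ; ∷-injectiveʳ; ++-cancelˡ)
open import Data.List.Relation.Binary.BagAndSetEquality using (∼bag⇒↭)
open import Data.List.Relation.Binary.Disjoint.Propositional using (Disjoint)
open import Data.List.Relation.Binary.Permutation.Propositional using (_↭_; ↭⇒↭ₛ)
open import Data.List.Relation.Binary.Permutation.Propositional.Properties using () renaming (map⁺ to ↭-map⁺)
open import Data.List.Relation.Binary.Permutation.Setoid.Properties using (foldr-commMonoid)
open import Data.List.Relation.Unary.All as All using (All; []; _∷_)
import Data.List.Relation.Unary.All.Properties as AllP
import Data.List.Relation.Unary.AllPairs as AllPairs
import Data.List.Relation.Unary.AllPairs.Properties as AllPairsP
open import Data.List.Relation.Unary.Any as Any using (Any; here; there)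
open import Data.List.Relation.Unary.Unique.Propositional using (Unique; []; _∷_)
import Data.List.Relation.Unary.Unique.Propositional.Properties as Unique
open import Data.Nat as ℕ using (ℕ; zero; suc; _<_; _∸_; _!)
open import Data.Nat.Combinatorics using (_C_; nCn≡1; k>n⇒nCk≡0; nCk+nC[k+1]≡[n+1]C[k+1])
open import Data.Nat.Combinatorics.Base using (_P′_)
import Data.Nat.DivMod as ℕD
open import Data.Nat.ListAction.Properties using (sum-++)
import Data.Nat.Properties as ℕP
import Data.Nat.Tactic.RingSolver as ℕSolver
open import Data.Product using (_×_; _,_; proj₁; proj₂; ∃-syntax; ∃₂)
open import Data.Sum using (inj₁; inj₂)
open import Function using (_∘_; id)
open import Function.Bundles using (Equivalence; mk⇔)
open import Level using (0ℓ)
open import Relation.Binary.Bundles using (Setoid)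
open import Relation.Binary.Definitions using (Tri; tri<; tri≈; tri>)
open import Relation.Binary.PropositionalEquality
import Relation.Binary.Reasoning.Setoid as SetoidReasoning
open import Relation.Nullary using (Dec; ¬_)
open import Relation.Nullary.Decidable using (yes; no; does; dec-true; dec-false)
open import Relation.Nullary.Negation using (contradiction)
open import Relation.Nullary.Reflects using (ofʸ; ofⁿ)
import Relation.Unary as U

open import Algebra.Properties.Group (AbelianGroup.group ℤP.+-0-abelianGroup) using (∙-cancelˡ)

-- Formal power series

module ≗-Reasoning = SetoidReasoning (ℕ →-setoid ℤ)
open Setoid (ℕ →-setoid ℤ) using () renaming (sym to ≗-sym; trans to ≗-trans)

Σℤ-cong : ∀ n {f g : ℕ → ℤ} → (∀ {i} → i < n → f i ≡ g i) → Σℤ n f ≡ Σℤ n g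
Σℤ-cong zero    f≡g = refl
Σℤ-cong (suc n) f≡g = cong₂ _+_ (Σℤ-cong n (f≡g ∘ ℕP.m<n⇒m<1+n)) (f≡g (ℕP.n<1+n n))

Σℤ-suc : ∀ n (f : ℕ → ℤ) → Σℤ (suc n) f ≡ f 0 + Σℤ n (f ∘ suc)
Σℤ-suc zero    f = trans (ℤP.+-identityˡ (f 0)) (sym (ℤP.+-identityʳ (f 0)))
Σℤ-suc (suc n) f = trans (cong (_+ f (suc n)) (Σℤ-suc n f)) (ℤP.+-assoc (f 0) _ _)

Σℤ-+ : ∀ n (f g : ℕ → ℤ) → Σℤ n (λ i → f i + g i) ≡ Σℤ n f + Σℤ n g
Σℤ-+ zero    f g = refl
Σℤ-+ (suc n) f g = trans (cong (_+ (f n + g n)) (Σℤ-+ n f g)) (shuffle (Σℤ n f) (Σℤ n g) (f n) (g n))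
  where
  shuffle : ∀ a b c d → a + b + (c + d) ≡ a + c + (b + d)
  shuffle = solve-∀

Σℤ-*ˡ : ∀ n c (f : ℕ → ℤ) → Σℤ n (λ i → c * f i) ≡ c * Σℤ n f
Σℤ-*ˡ zero    c f = sym (ℤP.*-zeroʳ c)
Σℤ-*ˡ (suc n) c f = trans (cong (_+ c * f n) (Σℤ-*ˡ n c f)) (sym (ℤP.*-distribˡ-+ c (Σℤ n f) (f n)))

Σℤ-zero : ∀ n {f : ℕ → ℤ} → (∀ {i} → i < n → f i ≡ + 0) → Σℤ n f ≡ + 0
Σℤ-zero zero    f≡0 = refl
Σℤ-zero (suc n) f≡0 = cong₂ _+_ (Σℤ-zero n (f≡0 ∘ ℕP.m<n⇒m<1+n)) (f≡0 (ℕP.n<1+n n))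

⋆-local : ∀ n {f f′ g g′ : Series} → (∀ {i} → i ℕ.≤ n → f i ≡ f′ i) → (∀ {i} → i ℕ.≤ n → g i ≡ g′ i) →
          (f ⋆ g) n ≡ (f′ ⋆ g′) n
⋆-local n f≡f′ g≡g′ = Σℤ-cong (suc n) λ {i} i<1+n →
  cong₂ _*_ (f≡f′ (ℕP.≤-pred i<1+n)) (g≡g′ (ℕP.m∸n≤m n i))

⋆-cong : ∀ {f f′ g g′ : Series} → f ≗ f′ → g ≗ g′ → f ⋆ g ≗ f′ ⋆ g′
⋆-cong f≗f′ g≗g′ n = ⋆-local n (λ {i} _ → f≗f′ i) (λ {i} _ → g≗g′ i)

⋆-congˡ : ∀ f {g g′ : Series} → g ≗ g′ → f ⋆ g ≗ f ⋆ g′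
⋆-congˡ f = ⋆-cong {f} {f} (λ _ → refl)

⋆-congʳ : ∀ g {f f′ : Series} → f ≗ f′ → f ⋆ g ≗ f′ ⋆ g
⋆-congʳ g f≗f′ = ⋆-cong {g = g} {g} f≗f′ (λ _ → refl)

⋆-suc : ∀ (f g : Series) n → (f ⋆ g) (suc n) ≡ f 0 * g (suc n) + ((f ∘ suc) ⋆ g) n
⋆-suc f g n = Σℤ-suc (suc n) (λ i → f i * g (suc n ∸ i))

⋆-distribʳ-+ : ∀ (f g h : Series) n → ((λ i → f i + g i) ⋆ h) n ≡ (f ⋆ h) n + (g ⋆ h) n
⋆-distribʳ-+ f g h n = trans (Σℤ-cong (suc n) λ {i} _ → ℤP.*-distribʳ-+ (h (n ∸ i)) (f i) (g i))
                             (Σℤ-+ (suc n) _ _)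

⋆-*ˡ : ∀ c (f h : Series) n → ((λ i → c * f i) ⋆ h) n ≡ c * (f ⋆ h) n
⋆-*ˡ c f h n = trans (Σℤ-cong (suc n) λ {i} _ → ℤP.*-assoc c (f i) (h (n ∸ i)))
                     (Σℤ-*ˡ (suc n) c _)

⋆-assoc : ∀ (f g h : Series) → (f ⋆ g) ⋆ h ≗ f ⋆ (g ⋆ h)
⋆-assoc f g h zero = rearrange (f 0) (g 0) (h 0)
  where
  rearrange : ∀ a b c → + 0 + (+ 0 + a * b) * c ≡ + 0 + a * (+ 0 + b * c)
  rearrange = solve-∀
⋆-assoc f g h (suc n) = begin
  ((f ⋆ g) ⋆ h) (suc n)
    ≡⟨ ⋆-suc (f ⋆ g) h n ⟩
  (f ⋆ g) 0 * h (suc n) + (((f ⋆ g) ∘ suc) ⋆ h) n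
    ≡⟨ cong (_+_ ((f ⋆ g) 0 * h (suc n))) (begin
         (((f ⋆ g) ∘ suc) ⋆ h) n
           ≡⟨ ⋆-congʳ h (⋆-suc f g) n ⟩
         ((λ i → f 0 * g (suc i) + ((f ∘ suc) ⋆ g) i) ⋆ h) n
           ≡⟨ ⋆-distribʳ-+ (λ i → f 0 * g (suc i)) ((f ∘ suc) ⋆ g) h n ⟩
         ((λ i → f 0 * g (suc i)) ⋆ h) n + (((f ∘ suc) ⋆ g) ⋆ h) n
           ≡⟨ cong₂ _+_ (⋆-*ˡ (f 0) (g ∘ suc) h n) (⋆-assoc (f ∘ suc) g h n) ⟩
         f 0 * ((g ∘ suc) ⋆ h) n + ((f ∘ suc) ⋆ (g ⋆ h)) n ∎) ⟩
  (+ 0 + f 0 * g 0) * h (suc n) + (f 0 * ((g ∘ suc) ⋆ h) n + ((f ∘ suc) ⋆ (g ⋆ h)) n)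
    ≡⟨ rearrange (f 0) (g 0) (h (suc n)) _ _ ⟩
  f 0 * (g 0 * h (suc n) + ((g ∘ suc) ⋆ h) n) + ((f ∘ suc) ⋆ (g ⋆ h)) n
    ≡⟨ cong (λ z → f 0 * z + ((f ∘ suc) ⋆ (g ⋆ h)) n) (⋆-suc g h n) ⟨
  f 0 * (g ⋆ h) (suc n) + ((f ∘ suc) ⋆ (g ⋆ h)) n
    ≡⟨ ⋆-suc f (g ⋆ h) n ⟨
  (f ⋆ (g ⋆ h)) (suc n) ∎
  where
  open ≡-Reasoning
  rearrange : ∀ a b c d e → (+ 0 + a * b) * c + (a * d + e) ≡ a * (b * c + d) + e
  rearrange = solve-∀

⋆-comm : ∀ (f g : Series) → f ⋆ g ≗ g ⋆ f
⋆-comm f g zero = cong (_+_ (+ 0)) (ℤP.*-comm (f 0) (g 0))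
⋆-comm f g (suc zero) = rearrange (f 0) (f 1) (g 0) (g 1)
  where
  rearrange : ∀ a b c d → + 0 + a * d + b * c ≡ + 0 + c * b + d * a
  rearrange = solve-∀
⋆-comm f g (suc (suc n)) = begin
  (f ⋆ g) (2 ℕ.+ n)
    ≡⟨ ⋆-suc f g (suc n) ⟩
  f 0 * g (2 ℕ.+ n) + ((f ∘ suc) ⋆ g) (suc n)
    ≡⟨ cong (_+_ (f 0 * g (2 ℕ.+ n))) (trans (⋆-comm (f ∘ suc) g (suc n)) (⋆-suc g (f ∘ suc) n)) ⟩
  f 0 * g (2 ℕ.+ n) + (g 0 * f (2 ℕ.+ n) + ((g ∘ suc) ⋆ (f ∘ suc)) n)
    ≡⟨ cong (λ z → f 0 * g (2 ℕ.+ n) + (g 0 * f (2 ℕ.+ n) + z)) (⋆-comm (g ∘ suc) (f ∘ suc) n) ⟩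
  f 0 * g (2 ℕ.+ n) + (g 0 * f (2 ℕ.+ n) + ((f ∘ suc) ⋆ (g ∘ suc)) n)
    ≡⟨ swap (f 0 * g (2 ℕ.+ n)) (g 0 * f (2 ℕ.+ n)) _ ⟩
  g 0 * f (2 ℕ.+ n) + (f 0 * g (2 ℕ.+ n) + ((f ∘ suc) ⋆ (g ∘ suc)) n)
    ≡⟨ cong (_+_ (g 0 * f (2 ℕ.+ n))) (trans (sym (⋆-suc f (g ∘ suc) n)) (⋆-comm f (g ∘ suc) (suc n))) ⟩
  g 0 * f (2 ℕ.+ n) + ((g ∘ suc) ⋆ f) (suc n)
    ≡⟨ ⋆-suc g f (suc n) ⟨
  (g ⋆ f) (2 ℕ.+ n) ∎
  where
  open ≡-Reasoning
  swap : ∀ a b c → a + (b + c) ≡ b + (a + c)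
  swap = solve-∀

⋆-identityˡ : ∀ (f : Series) → oneS ⋆ f ≗ f
⋆-identityˡ f n = begin
  (oneS ⋆ f) n                               ≡⟨ Σℤ-suc n (λ i → oneS i * f (n ∸ i)) ⟩
  + 1 * f n + Σℤ n (λ i → + 0 * f (n ∸ suc i)) ≡⟨ cong₂ _+_ (ℤP.*-identityˡ (f n)) (Σℤ-zero n λ _ → refl) ⟩
  f n + + 0                                  ≡⟨ ℤP.+-identityʳ (f n) ⟩
  f n ∎
  where open ≡-Reasoning

⋆-identityʳ : ∀ (f : Series) → f ⋆ oneS ≗ f
⋆-identityʳ f n = trans (⋆-comm f oneS n) (⋆-identityˡ f n)

⋆-commutativeMonoid : CommutativeMonoid 0ℓ 0ℓ
⋆-commutativeMonoid = record
  { Carrier = Series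
  ; _≈_ = _≗_
  ; _∙_ = _⋆_
  ; ε = oneS
  ; isCommutativeMonoid = record
    { isMonoid = record
      { isSemigroup = record
        { isMagma = record { isEquivalence = Setoid.isEquivalence (ℕ →-setoid ℤ) ; ∙-cong = ⋆-cong }
        ; assoc = ⋆-assoc
        }
      ; identity = ⋆-identityˡ , ⋆-identityʳ
      }
    ; comm = ⋆-comm
    }
  }

open import Algebra.Properties.CommutativeSemigroup (CommutativeMonoid.commutativeSemigroup ⋆-commutativeMonoid)
  using (interchange; x∙yz≈y∙xz; xy∙z≈y∙xz)

⋆-cancelʳ : ∀ {e e′ p : Series} → p 0 ≡ + 1 → e ⋆ p ≗ e′ ⋆ p → e ≗ e′
⋆-cancelʳ {e} {e′} {p} p0≡1 eq n = agreeBelow (suc n) (ℕP.n<1+n n)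
  where
  lastTerm : ∀ (x : Series) n → x n * p (n ∸ n) ≡ x n
  lastTerm x n rewrite ℕP.n∸n≡0 n | p0≡1 = ℤP.*-identityʳ (x n)

  agreeAt : ∀ n → (∀ {i} → i < n → e i ≡ e′ i) → e n ≡ e′ n
  agreeAt n below = begin
    e n               ≡⟨ lastTerm e n ⟨
    e n * p (n ∸ n)   ≡⟨ ∙-cancelˡ (Σℤ n (λ i → e′ i * p (n ∸ i))) _ _ (trans (cong (_+ _) (sym earlier)) (eq n)) ⟩
    e′ n * p (n ∸ n)  ≡⟨ lastTerm e′ n ⟩
    e′ n ∎
    where
    open ≡-Reasoning
    earlier : Σℤ n (λ i → e i * p (n ∸ i)) ≡ Σℤ n (λ i → e′ i * p (n ∸ i))
    earlier = Σℤ-cong n λ {i} i<n → cong (_* p (n ∸ i)) (below i<n)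

  agreeBelow : ∀ n {i} → i < n → e i ≡ e′ i
  agreeBelow (suc n) i<1+n with ℕP.m<1+n⇒m<n∨m≡n i<1+n
  ... | inj₁ i<n  = agreeBelow n i<n
  ... | inj₂ refl = agreeAt n (agreeBelow n)

-- Binomial coefficients with integer upper argument

suc-P′-suc : ∀ n k → suc n P′ suc k ≡ suc n ℕ.* (n P′ k)
suc-P′-suc n zero    = refl
suc-P′-suc n (suc k) = trans (cong ((n ∸ k) ℕ.*_) (suc-P′-suc n k)) (swap (n ∸ k) (suc n) (n P′ k))
  where
  swap : ∀ a b c → a ℕ.* (b ℕ.* c) ≡ b ℕ.* (a ℕ.* c)
  swap = ℕSolver.solve-∀

<⇒P′≡0 : ∀ {n k} → n < k → n P′ k ≡ 0
<⇒P′≡0 {n} {suc k} n<1+k with ℕP.m<1+n⇒m<n∨m≡n n<1+k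
... | inj₁ n<k  = trans (cong ((n ∸ k) ℕ.*_) (<⇒P′≡0 n<k)) (ℕP.*-zeroʳ (n ∸ k))
... | inj₂ refl = cong (ℕ._* (n P′ n)) (ℕP.n∸n≡0 n)

k!*nCk≡nP′k : ∀ n k → k ! ℕ.* (n C k) ≡ n P′ k
k!*nCk≡nP′k n       zero    = refl
k!*nCk≡nP′k zero    (suc k) = trans (ℕP.*-zeroʳ (suc k !)) (sym (cong (ℕ._* (0 P′ k)) (ℕP.0∸n≡0 k)))
k!*nCk≡nP′k (suc n) (suc k) = begin
  suc k ! ℕ.* (suc n C suc k)
    ≡⟨ cong (suc k ! ℕ.*_) (nCk+nC[k+1]≡[n+1]C[k+1] n k) ⟨
  suc k ! ℕ.* (n C k ℕ.+ n C suc k)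
    ≡⟨ ℕP.*-distribˡ-+ (suc k !) (n C k) (n C suc k) ⟩
  suc k ! ℕ.* (n C k) ℕ.+ suc k ! ℕ.* (n C suc k)
    ≡⟨ cong₂ ℕ._+_ (ℕP.*-assoc (suc k) (k !) (n C k)) (k!*nCk≡nP′k n (suc k)) ⟩
  suc k ℕ.* (k ! ℕ.* (n C k)) ℕ.+ n P′ suc k
    ≡⟨ cong (λ z → suc k ℕ.* z ℕ.+ n P′ suc k) (k!*nCk≡nP′k n k) ⟩
  suc k ℕ.* (n P′ k) ℕ.+ (n ∸ k) ℕ.* (n P′ k)
    ≡⟨ ℕP.*-distribʳ-+ (n P′ k) (suc k) (n ∸ k) ⟨
  (suc k ℕ.+ (n ∸ k)) ℕ.* (n P′ k)
    ≡⟨ factorCount ⟩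
  suc n ℕ.* (n P′ k)
    ≡⟨ suc-P′-suc n k ⟨
  suc n P′ suc k ∎
  where
  open ≡-Reasoning
  factorCount : (suc k ℕ.+ (n ∸ k)) ℕ.* (n P′ k) ≡ suc n ℕ.* (n P′ k)
  factorCount with ℕP.≤-<-connex k n
  ... | inj₁ k≤n = cong (λ m → suc m ℕ.* (n P′ k)) (ℕP.m+[n∸m]≡n k≤n)
  ... | inj₂ n<k rewrite <⇒P′≡0 n<k = trans (ℕP.*-zeroʳ (suc k ℕ.+ (n ∸ k))) (sym (ℕP.*-zeroʳ (suc n)))

-- Negative upper arguments via upper negation: (-(n+1) choose k) = (-1)^k ((n+k) choose k).
choose : ℤ → ℕ → ℤ
choose (+ n)    k = + (n C k)
choose -[1+ n ] k = -1ℤ ^ k * + ((n ℕ.+ k) C k)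

fallingℤ-+ : ∀ n k → fallingℤ (+ n) k ≡ + (n P′ k)
fallingℤ-+ n zero    = refl
fallingℤ-+ n (suc k) with ℕP.≤-<-connex k n
... | inj₁ k≤n = begin
  fallingℤ (+ n) k * (+ n - + k)   ≡⟨ cong₂ _*_ (fallingℤ-+ n k) (trans (ℤP.m-n≡m⊖n n k) (ℤP.⊖-≥ k≤n)) ⟩
  + (n P′ k) * + (n ∸ k)           ≡⟨ ℤP.pos-* (n P′ k) (n ∸ k) ⟨
  + ((n P′ k) ℕ.* (n ∸ k))         ≡⟨ cong +_ (ℕP.*-comm (n P′ k) (n ∸ k)) ⟩
  + ((n ∸ k) ℕ.* (n P′ k))         ∎
  where open ≡-Reasoning
... | inj₂ n<k = begin
  fallingℤ (+ n) k * (+ n - + k)   ≡⟨ cong (_* (+ n - + k)) (trans (fallingℤ-+ n k) (cong +_ (<⇒P′≡0 n<k))) ⟩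
  + 0 * (+ n - + k)                ≡⟨ ℤP.*-zeroˡ (+ n - + k) ⟩
  + 0                              ≡⟨ cong +_ (trans (cong ((n ∸ k) ℕ.*_) (<⇒P′≡0 n<k)) (ℕP.*-zeroʳ (n ∸ k))) ⟨
  + ((n ∸ k) ℕ.* (n P′ k))         ∎
  where open ≡-Reasoning

fallingℤ≡k!*choose : ∀ x k → fallingℤ x k ≡ + (k !) * choose x k
fallingℤ≡k!*choose (+ n) k = begin
  fallingℤ (+ n) k      ≡⟨ fallingℤ-+ n k ⟩
  + (n P′ k)            ≡⟨ cong +_ (k!*nCk≡nP′k n k) ⟨
  + (k ! ℕ.* (n C k))   ≡⟨ ℤP.pos-* (k !) (n C k) ⟩
  + (k !) * + (n C k)   ∎
  where open ≡-Reasoning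
fallingℤ≡k!*choose -[1+ n ] zero    = refl
fallingℤ≡k!*choose -[1+ n ] (suc k) = begin
  fallingℤ -[1+ n ] k * (-[1+ n ] - + k)
    ≡⟨ cong₂ _*_ (fallingℤ≡k!*choose -[1+ n ] k) lastFactor ⟩
  + (k !) * (-1ℤ ^ k * + ((n ℕ.+ k) C k)) * - + suc (n ℕ.+ k)
    ≡⟨ rearrange (+ (k !)) (-1ℤ ^ k) (+ ((n ℕ.+ k) C k)) (+ suc (n ℕ.+ k)) ⟩
  -1ℤ ^ suc k * (+ suc (n ℕ.+ k) * (+ (k !) * + ((n ℕ.+ k) C k)))
    ≡⟨ cong (-1ℤ ^ suc k *_) (trans (ℤP.pos-* (suc (n ℕ.+ k)) _) (cong (+ suc (n ℕ.+ k) *_) (ℤP.pos-* (k !) _))) ⟨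
  -1ℤ ^ suc k * + (suc (n ℕ.+ k) ℕ.* (k ! ℕ.* ((n ℕ.+ k) C k)))
    ≡⟨ cong (λ m → -1ℤ ^ suc k * + m) natural ⟩
  -1ℤ ^ suc k * + (suc k ! ℕ.* ((n ℕ.+ suc k) C suc k))
    ≡⟨ cong (-1ℤ ^ suc k *_) (ℤP.pos-* (suc k !) _) ⟩
  -1ℤ ^ suc k * (+ (suc k !) * + ((n ℕ.+ suc k) C suc k))
    ≡⟨ swap (-1ℤ ^ suc k) (+ (suc k !)) _ ⟩
  + (suc k !) * (-1ℤ ^ suc k * + ((n ℕ.+ suc k) C suc k)) ∎
  where
  open ≡-Reasoning
  lastFactor : -[1+ n ] - + k ≡ - + suc (n ℕ.+ k)
  lastFactor = trans (sym (ℤP.neg-distrib-+ (+ suc n) (+ k))) (cong -_ (sym (ℤP.pos-+ (suc n) k)))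
  natural : suc (n ℕ.+ k) ℕ.* (k ! ℕ.* ((n ℕ.+ k) C k)) ≡ suc k ! ℕ.* ((n ℕ.+ suc k) C suc k)
  natural = begin
    suc (n ℕ.+ k) ℕ.* (k ! ℕ.* ((n ℕ.+ k) C k))  ≡⟨ cong (suc (n ℕ.+ k) ℕ.*_) (k!*nCk≡nP′k (n ℕ.+ k) k) ⟩
    suc (n ℕ.+ k) ℕ.* ((n ℕ.+ k) P′ k)           ≡⟨ suc-P′-suc (n ℕ.+ k) k ⟨
    suc (n ℕ.+ k) P′ suc k                       ≡⟨ cong (_P′ suc k) (ℕP.+-suc n k) ⟨
    (n ℕ.+ suc k) P′ suc k                       ≡⟨ k!*nCk≡nP′k (n ℕ.+ suc k) (suc k) ⟨
    suc k ! ℕ.* ((n ℕ.+ suc k) C suc k)          ∎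
  rearrange : ∀ f s b m → f * (s * b) * - m ≡ -1ℤ * s * (m * (f * b))
  rearrange = solve-∀
  swap : ∀ a b c → a * (b * c) ≡ b * (a * c)
  swap = solve-∀

[d*i]/ℕd≡i : ∀ (i : ℤ) d .{{_ : ℕ.NonZero d}} → (+ d * i) /ℕ d ≡ i
[d*i]/ℕd≡i (+ n) d = begin
  (+ d * + n) /ℕ d    ≡⟨ cong (_/ℕ d) (ℤP.pos-* d n) ⟨
  + (d ℕ.* n ℕ./ d)   ≡⟨ cong (λ m → + (m ℕ./ d)) (ℕP.*-comm d n) ⟩
  + (n ℕ.* d ℕ./ d)   ≡⟨ cong +_ (ℕD.m*n/n≡m n d) ⟩
  + n                 ∎
  where open ≡-Reasoning
[d*i]/ℕd≡i -[1+ n ] (suc d) = negative (n ℕ.+ d ℕ.* suc n) (cong suc (expand n d))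
  where
  expand : ∀ n d → n ℕ.+ d ℕ.* suc n ≡ d ℕ.+ n ℕ.* suc d
  expand = ℕSolver.solve-∀
  negative : ∀ k → suc k ≡ suc n ℕ.* suc d → -[1+ k ] /ℕ suc d ≡ -[1+ n ]
  negative k eq rewrite trans (cong (ℕ._% suc d) eq) (ℕD.m*n%n≡0 (suc n) (suc d)) =
    cong (λ m → - + m) (trans (cong (ℕ._/ suc d) eq) (ℕD.m*n/n≡m (suc n) (suc d)))

binomℤ≡choose : ∀ x k → binomℤ x k ≡ choose x k
binomℤ≡choose x k = trans (cong (λ z → _/ℕ_ z (k !) {{k ℕP.!≢0}}) (fallingℤ≡k!*choose x k))
                          ([d*i]/ℕd≡i (choose x k) (k !) {{k ℕP.!≢0}})

choose-pascal : ∀ x k → choose (x + + 1) (suc k) ≡ choose x (suc k) + choose x k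
choose-pascal (+ n) k = begin
  choose (+ n + + 1) (suc k)    ≡⟨ cong (λ z → choose z (suc k)) (trans (sym (ℤP.pos-+ n 1)) (cong +_ (ℕP.+-comm n 1))) ⟩
  + (suc n C suc k)             ≡⟨ cong +_ (nCk+nC[k+1]≡[n+1]C[k+1] n k) ⟨
  + (n C k ℕ.+ n C suc k)       ≡⟨ ℤP.pos-+ (n C k) (n C suc k) ⟩
  + (n C k) + + (n C suc k)     ≡⟨ ℤP.+-comm (+ (n C k)) (+ (n C suc k)) ⟩
  + (n C suc k) + + (n C k)     ∎
  where open ≡-Reasoning
choose-pascal -[1+ zero ] k = sym (begin
  -1ℤ ^ suc k * + (suc k C suc k) + -1ℤ ^ k * + (k C k)
    ≡⟨ cong₂ (λ a b → -1ℤ ^ suc k * + a + -1ℤ ^ k * + b) (nCn≡1 (suc k)) (nCn≡1 k) ⟩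
  -1ℤ * -1ℤ ^ k * + 1 + -1ℤ ^ k * + 1
    ≡⟨ cancel (-1ℤ ^ k) ⟩
  + 0 ∎)
  where
  open ≡-Reasoning
  cancel : ∀ s → -1ℤ * s * + 1 + s * + 1 ≡ + 0
  cancel = solve-∀
choose-pascal -[1+ suc n ] k = sym (begin
  -1ℤ ^ suc k * + (suc (n ℕ.+ suc k) C suc k) + -1ℤ ^ k * + (suc (n ℕ.+ k) C k)
    ≡⟨ cong₂ (λ a b → -1ℤ ^ suc k * a + -1ℤ ^ k * + (b C k))
             (trans (cong +_ (sym (nCk+nC[k+1]≡[n+1]C[k+1] (n ℕ.+ suc k) k))) (ℤP.pos-+ ((n ℕ.+ suc k) C k) ((n ℕ.+ suc k) C suc k)))
             (sym (ℕP.+-suc n k)) ⟩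
  -1ℤ * -1ℤ ^ k * (+ ((n ℕ.+ suc k) C k) + + ((n ℕ.+ suc k) C suc k)) + -1ℤ ^ k * + ((n ℕ.+ suc k) C k)
    ≡⟨ cancel (-1ℤ ^ k) _ _ ⟩
  -1ℤ ^ suc k * + ((n ℕ.+ suc k) C suc k) ∎)
  where
  open ≡-Reasoning
  cancel : ∀ s a b → -1ℤ * s * (a + b) + s * a ≡ -1ℤ * s * b
  cancel = solve-∀

choose-0 : ∀ x → choose x 0 ≡ + 1
choose-0 (+ n)    = refl
choose-0 -[1+ n ] = refl

-- The coefficient of q^c in (1 - q)^(-y).
multichoose : ℤ → ℕ → ℤ
multichoose y c = choose (y + + c - + 1) c

multichoose-pascal : ∀ y k → multichoose (y + + 1) (suc k) ≡ multichoose y (suc k) + multichoose (y + + 1) k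
multichoose-pascal y k = begin
  choose (y + + 1 + + suc k - + 1) (suc k)
    ≡⟨ cong (λ z → choose z (suc k)) (shift₁ y (+ k)) ⟩
  choose (y + + k + + 1) (suc k)
    ≡⟨ choose-pascal (y + + k) k ⟩
  choose (y + + k) (suc k) + choose (y + + k) k
    ≡⟨ cong₂ _+_ (cong (λ z → choose z (suc k)) (shift₂ y (+ k))) (cong (λ z → choose z k) (shift₃ y (+ k))) ⟩
  choose (y + + suc k - + 1) (suc k) + choose (y + + 1 + + k - + 1) k ∎
  where
  open ≡-Reasoning
  shift₁ : ∀ y k → y + + 1 + (+ 1 + k) - + 1 ≡ y + k + + 1
  shift₁ = solve-∀
  shift₂ : ∀ y k → y + k ≡ y + (+ 1 + k) - + 1
  shift₂ = solve-∀
  shift₃ : ∀ y k → y + k ≡ y + + 1 + k - + 1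
  shift₃ = solve-∀

multichoose-vanishes : ∀ r c → r < c → multichoose (- + r) c ≡ + 0
multichoose-vanishes r c r<c = begin
  choose (- + r + + c - + 1) c        ≡⟨ cong (λ z → choose z c) (trans (cong (λ z → - + r + + z - + 1) (sym c≡)) top) ⟩
  choose (+ e) c                      ≡⟨ cong +_ (k>n⇒nCk≡0 (subst (e <_) c≡ (ℕP.m<n+m e ℕ.z<s))) ⟩
  + 0 ∎
  where
  open ≡-Reasoning
  e = c ∸ suc r
  c≡ : suc r ℕ.+ e ≡ c
  c≡ = ℕP.m+[n∸m]≡n r<c
  top : - + r + + (suc r ℕ.+ e) - + 1 ≡ + e
  top = trans (cong (λ z → - + r + z - + 1) (trans (ℤP.pos-+ (suc r) e) (cong (_+ + e) (ℤP.pos-+ 1 r)))) (solve (+ r) (+ e))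
    where
    solve : ∀ r e → - r + (+ 1 + r + e) - + 1 ≡ e
    solve = solve-∀

-- The product ∏_{i ≥ 1} (1 - q^i)^(-M_i)

q^_ : ℕ → Series
(q^ x) s = if does (s ℕ.≟ x) then + 1 else + 0

1-q^_ : ℕ → Series
(1-q^ x) s = oneS s - (q^ x) s

q^-self : ∀ x → (q^ x) x ≡ + 1
q^-self x rewrite dec-true (x ℕ.≟ x) refl = refl

q^-other : ∀ {x s} → s ≢ x → (q^ x) s ≡ + 0
q^-other {x} {s} s≢x rewrite dec-false (s ℕ.≟ x) s≢x = refl

Σℤ-q^-≥ : ∀ n x (h : ℕ → ℤ) → n ℕ.≤ x → Σℤ n (λ i → (q^ x) i * h i) ≡ + 0
Σℤ-q^-≥ n x h n≤x = Σℤ-zero n λ {i} i<n → cong (_* h i) (q^-other (ℕP.<⇒≢ (ℕP.<-≤-trans i<n n≤x)))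

Σℤ-q^-< : ∀ n x (h : ℕ → ℤ) → x < n → Σℤ n (λ i → (q^ x) i * h i) ≡ h x
Σℤ-q^-< (suc n) x h x<1+n with ℕP.m<1+n⇒m<n∨m≡n x<1+n
... | inj₁ x<n  = begin
  Σℤ n (λ i → (q^ x) i * h i) + (q^ x) n * h n  ≡⟨ cong₂ _+_ (Σℤ-q^-< n x h x<n) (cong (_* h n) (q^-other (ℕP.>⇒≢ x<n))) ⟩
  h x + + 0 * h n                             ≡⟨ ℤP.+-identityʳ (h x) ⟩
  h x ∎
  where open ≡-Reasoning
... | inj₂ refl = begin
  Σℤ x (λ i → (q^ x) i * h i) + (q^ x) x * h x  ≡⟨ cong₂ _+_ (Σℤ-q^-≥ x x h ℕP.≤-refl) (cong (_* h x) (q^-self x)) ⟩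
  + 0 + + 1 * h x                             ≡⟨ trans (ℤP.+-identityˡ _) (ℤP.*-identityˡ (h x)) ⟩
  h x ∎
  where open ≡-Reasoning

1-q^⋆ : ∀ x (f : Series) s → ((1-q^ x) ⋆ f) s ≡ f s - Σℤ (suc s) (λ i → (q^ x) i * f (s ∸ i))
1-q^⋆ x f s = begin
  ((1-q^ x) ⋆ f) s
    ≡⟨ Σℤ-cong (suc s) (λ {i} _ → distrib (oneS i) ((q^ x) i) (f (s ∸ i))) ⟩
  Σℤ (suc s) (λ i → oneS i * f (s ∸ i) + -1ℤ * ((q^ x) i * f (s ∸ i)))
    ≡⟨ Σℤ-+ (suc s) _ _ ⟩
  (oneS ⋆ f) s + Σℤ (suc s) (λ i → -1ℤ * ((q^ x) i * f (s ∸ i)))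
    ≡⟨ cong₂ _+_ (⋆-identityˡ f s) (trans (Σℤ-*ˡ (suc s) -1ℤ _) (ℤP.-1*i≡-i _)) ⟩
  f s - Σℤ (suc s) (λ i → (q^ x) i * f (s ∸ i)) ∎
  where
  open ≡-Reasoning
  distrib : ∀ a b c → (a - b) * c ≡ a * c + -1ℤ * (b * c)
  distrib = solve-∀

1-q^⋆-< : ∀ x (f : Series) s → s < x → ((1-q^ x) ⋆ f) s ≡ f s
1-q^⋆-< x f s s<x = trans (1-q^⋆ x f s) (trans (cong (_-_ (f s)) (Σℤ-q^-≥ (suc s) x _ s<x)) (ℤP.+-identityʳ (f s)))

1-q^⋆-≥ : ∀ x (f : Series) s → x ℕ.≤ s → ((1-q^ x) ⋆ f) s ≡ f s - f (s ∸ x)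
1-q^⋆-≥ x f s x≤s = trans (1-q^⋆ x f s) (cong (_-_ (f s)) (Σℤ-q^-< (suc s) x (λ i → f (s ∸ i)) (ℕ.s≤s x≤s)))

-- (1 - q^(1+j))^(-y), by the negative binomial theorem.
negBinomial : ℕ → ℤ → Series
negBinomial j y u = if does (u ℕ.% suc j ℕ.≟ 0) then multichoose y (u ℕ./ suc j) else + 0

negBinomial-divisible : ∀ j y u → u ℕ.% suc j ≡ 0 → negBinomial j y u ≡ multichoose y (u ℕ./ suc j)
negBinomial-divisible j y u ∣u rewrite dec-true (u ℕ.% suc j ℕ.≟ 0) ∣u = refl

negBinomial-indivisible : ∀ j y u → u ℕ.% suc j ≢ 0 → negBinomial j y u ≡ + 0
negBinomial-indivisible j y u ∤u rewrite dec-false (u ℕ.% suc j ℕ.≟ 0) ∤u = refl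

negBinomial-< : ∀ j y {u} → u < suc j → negBinomial j y u ≡ oneS u
negBinomial-< j y {zero}  _     = choose-0 (y + + 0 - + 1)
negBinomial-< j y {suc u} u<1+j = negBinomial-indivisible j y (suc u) (λ ∣u → contradiction (trans (sym (ℕD.m<n⇒m%n≡m u<1+j)) ∣u) λ ())

negBinomial-0 : ∀ j → negBinomial j (+ 0) ≗ oneS
negBinomial-0 j zero = negBinomial-< j (+ 0) ℕ.z<s
negBinomial-0 j (suc u) with suc u ℕ.% suc j ℕ.≟ 0
... | no ∤u = negBinomial-indivisible j (+ 0) (suc u) ∤u
... | yes ∣u = trans (negBinomial-divisible j (+ 0) (suc u) ∣u) (vanishes (suc u ℕ./ suc j) refl)
  where
  vanishes : ∀ m → suc u ℕ./ suc j ≡ m → multichoose (+ 0) m ≡ + 0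
  vanishes zero    u/x≡0 = contradiction (trans (sym (ℕD.m<n⇒m%n≡m (ℕD.m/n≡0⇒m<n {suc u} {suc j} u/x≡0))) ∣u) λ ()
  vanishes (suc m) _     = multichoose-vanishes 0 (suc m) ℕ.z<s

negBinomial-difference : ∀ j y {s} → suc j ℕ.≤ s →
                         negBinomial j (y + + 1) s - negBinomial j (y + + 1) (s ∸ suc j) ≡ negBinomial j y s
negBinomial-difference j y {s} x≤s with s ℕ.% suc j ℕ.≟ 0
... | no ∤s = begin
  negBinomial j (y + + 1) s - negBinomial j (y + + 1) (s ∸ x)
    ≡⟨ cong₂ _-_ (negBinomial-indivisible j (y + + 1) s ∤s)
                 (negBinomial-indivisible j (y + + 1) (s ∸ x) (∤s ∘ trans (sym sameResidue))) ⟩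
  + 0                ≡⟨ negBinomial-indivisible j y s ∤s ⟨
  negBinomial j y s ∎
  where
  open ≡-Reasoning
  x = suc j
  sameResidue : (s ∸ x) ℕ.% x ≡ s ℕ.% x
  sameResidue = ℕD.m≤n⇒[n∸m]%m≡n%m x≤s
... | yes ∣s = begin
  negBinomial j (y + + 1) s - negBinomial j (y + + 1) (s ∸ x)
    ≡⟨ cong₂ _-_ (negBinomial-divisible j (y + + 1) s ∣s)
                 (negBinomial-divisible j (y + + 1) (s ∸ x) (trans (ℕD.m≤n⇒[n∸m]%m≡n%m x≤s) ∣s)) ⟩
  multichoose (y + + 1) (s ℕ./ x) - multichoose (y + + 1) m
    ≡⟨ cong (λ q → multichoose (y + + 1) q - multichoose (y + + 1) m) quotient ⟩
  multichoose (y + + 1) (suc m) - multichoose (y + + 1) m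
    ≡⟨ cong (_- multichoose (y + + 1) m) (multichoose-pascal y m) ⟩
  multichoose y (suc m) + multichoose (y + + 1) m - multichoose (y + + 1) m
    ≡⟨ cancel (multichoose y (suc m)) (multichoose (y + + 1) m) ⟩
  multichoose y (suc m)
    ≡⟨ cong (multichoose y) quotient ⟨
  multichoose y (s ℕ./ x)
    ≡⟨ negBinomial-divisible j y s ∣s ⟨
  negBinomial j y s ∎
  where
  open ≡-Reasoning
  x = suc j
  m = (s ∸ x) ℕ./ x
  quotient : s ℕ./ x ≡ suc m
  quotient = ℕD.m/n≡1+[m∸n]/n x≤s
  cancel : ∀ a b → a + b - b ≡ a
  cancel = solve-∀

1-q^⋆negBinomial : ∀ j y → (1-q^ suc j) ⋆ negBinomial j (y + + 1) ≗ negBinomial j y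
1-q^⋆negBinomial j y s with ℕP.≤-<-connex (suc j) s
... | inj₁ x≤s = trans (1-q^⋆-≥ (suc j) (negBinomial j (y + + 1)) s x≤s) (negBinomial-difference j y x≤s)
... | inj₂ s<x = begin
  ((1-q^ suc j) ⋆ negBinomial j (y + + 1)) s  ≡⟨ 1-q^⋆-< (suc j) (negBinomial j (y + + 1)) s s<x ⟩
  negBinomial j (y + + 1) s                   ≡⟨ negBinomial-< j (y + + 1) s<x ⟩
  oneS s                                      ≡⟨ negBinomial-< j y s<x ⟨
  negBinomial j y s ∎
  where open ≡-Reasoning

partialProduct : (ℕ → ℤ) → ℕ → Series
partialProduct M zero    = oneS
partialProduct M (suc j) = negBinomial j (M (suc j)) ⋆ partialProduct M j

-- ∏_{i ≥ 1} (1 - q^i)^(-M i): factors with i > s do not touch the coefficient of q^s.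
productSeries : (ℕ → ℤ) → Series
productSeries M s = partialProduct M s s

partialProduct-suc : ∀ M j {s} → s ℕ.≤ j → partialProduct M (suc j) s ≡ partialProduct M j s
partialProduct-suc M j {s} s≤j = begin
  (negBinomial j (M (suc j)) ⋆ partialProduct M j) s
    ≡⟨ ⋆-local s {g = partialProduct M j} {g′ = partialProduct M j} (λ i≤s → negBinomial-< j (M (suc j)) (ℕ.s≤s (ℕP.≤-trans i≤s s≤j))) (λ _ → refl) ⟩
  (oneS ⋆ partialProduct M j) s
    ≡⟨ ⋆-identityˡ (partialProduct M j) s ⟩
  partialProduct M j s ∎
  where open ≡-Reasoning

partialProduct-stable : ∀ M j {s} → s ℕ.≤ j → partialProduct M j s ≡ productSeries M s
partialProduct-stable M j {s} s≤j with ℕP.m≤n⇒m<n∨m≡n s≤j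
partialProduct-stable M (suc j) s≤j | inj₁ s<1+j =
  trans (partialProduct-suc M j (ℕP.≤-pred s<1+j)) (partialProduct-stable M j (ℕP.≤-pred s<1+j))
... | inj₂ refl = refl

partialProduct-cong : ∀ {M M′} j → (∀ {i} → 1 ℕ.≤ i → i ℕ.≤ j → M i ≡ M′ i) →
                      partialProduct M j ≗ partialProduct M′ j
partialProduct-cong zero    M≡M′ = λ _ → refl
partialProduct-cong (suc j) M≡M′ =
  ⋆-cong (λ u → cong (λ y → negBinomial j y u) (M≡M′ ℕ.z<s ℕP.≤-refl))
         (partialProduct-cong j λ 1≤i i≤j → M≡M′ 1≤i (ℕP.m≤n⇒m≤1+n i≤j))

productSeries-0 : productSeries (λ _ → + 0) ≗ oneS
productSeries-0 s = partialProduct-0 s s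
  where
  partialProduct-0 : ∀ j → partialProduct (λ _ → + 0) j ≗ oneS
  partialProduct-0 zero    = λ _ → refl
  partialProduct-0 (suc j) = ≗-trans (⋆-cong (negBinomial-0 j) (partialProduct-0 j)) (⋆-identityˡ oneS)

module _ {M M⁺ : ℕ → ℤ} (x : ℕ) (bumped : M⁺ (suc x) ≡ M (suc x) + + 1)
         (unchanged : ∀ {i} → i ≢ suc x → M⁺ i ≡ M i) where

  1-q^⋆partialProduct : ∀ j → suc x ℕ.≤ j → (1-q^ suc x) ⋆ partialProduct M⁺ j ≗ partialProduct M j
  1-q^⋆partialProduct (suc j) x<1+j with j ℕ.≟ x
  ... | yes refl = begin
    (1-q^ suc j) ⋆ (negBinomial j (M⁺ (suc j)) ⋆ partialProduct M⁺ j)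
      ≈⟨ ⋆-assoc (1-q^ suc j) (negBinomial j (M⁺ (suc j))) (partialProduct M⁺ j) ⟨
    ((1-q^ suc j) ⋆ negBinomial j (M⁺ (suc j))) ⋆ partialProduct M⁺ j
      ≈⟨ ⋆-cong (≗-trans (⋆-congˡ (1-q^ suc j) (λ u → cong (λ y → negBinomial j y u) bumped))
                         (1-q^⋆negBinomial j (M (suc j))))
                (partialProduct-cong j λ _ i≤j → unchanged (ℕP.<⇒≢ (ℕ.s≤s i≤j))) ⟩
    negBinomial j (M (suc j)) ⋆ partialProduct M j ∎
    where open ≗-Reasoning
  ... | no j≢x = begin
    (1-q^ suc x) ⋆ (negBinomial j (M⁺ (suc j)) ⋆ partialProduct M⁺ j)
      ≈⟨ x∙yz≈y∙xz (1-q^ suc x) (negBinomial j (M⁺ (suc j))) (partialProduct M⁺ j) ⟩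
    negBinomial j (M⁺ (suc j)) ⋆ ((1-q^ suc x) ⋆ partialProduct M⁺ j)
      ≈⟨ ⋆-cong (λ u → cong (λ y → negBinomial j y u) (unchanged (j≢x ∘ ℕP.suc-injective)))
                (1-q^⋆partialProduct j (ℕP.≤∧≢⇒< (ℕP.≤-pred x<1+j) (j≢x ∘ sym))) ⟩
    negBinomial j (M (suc j)) ⋆ partialProduct M j ∎
    where open ≗-Reasoning

  1-q^⋆productSeries : (1-q^ suc x) ⋆ productSeries M⁺ ≗ productSeries M
  1-q^⋆productSeries s = begin
    ((1-q^ suc x) ⋆ productSeries M⁺) s
      ≡⟨ ⋆-local s {1-q^ suc x} {1-q^ suc x} (λ _ → refl) (λ i≤s → sym (partialProduct-stable M⁺ j (ℕP.≤-trans i≤s (ℕP.m≤m+n s (suc x))))) ⟩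
    ((1-q^ suc x) ⋆ partialProduct M⁺ j) s
      ≡⟨ 1-q^⋆partialProduct j (ℕP.m≤n+m (suc x) s) s ⟩
    partialProduct M j s
      ≡⟨ partialProduct-stable M j (ℕP.m≤m+n s (suc x)) ⟩
    productSeries M s ∎
    where
    open ≡-Reasoning
    j = s ℕ.+ suc x

-- The generating function

qint-< : ∀ {x k} → k < x → qint x k ≡ + 1
qint-< {x} {k} k<x with suc k ℕ.≤ᵇ x | ℕP.≤ᵇ-reflects-≤ (suc k) x
... | true  | _       = refl
... | false | ofⁿ k≮x = contradiction k<x k≮x

qint-≥ : ∀ {x k} → x ℕ.≤ k → qint x k ≡ + 0
qint-≥ {x} {k} x≤k with suc k ℕ.≤ᵇ x | ℕP.≤ᵇ-reflects-≤ (suc k) x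
... | false | _       = refl
... | true  | ofʸ k<x = contradiction k<x (ℕP.≤⇒≯ x≤k)

1-q⋆qint : ∀ x → (1-q^ 1) ⋆ qint x ≗ 1-q^ x
1-q⋆qint zero    zero = refl
1-q⋆qint (suc x) zero = refl
1-q⋆qint x (suc t) = trans (1-q^⋆-≥ 1 (qint x) (suc t) (ℕ.s≤s ℕ.z≤n)) (difference (ℕP.<-cmp x (suc t)))
  where
  difference : Tri (x < suc t) (x ≡ suc t) (suc t < x) → qint x (suc t) - qint x t ≡ + 0 - (q^ x) (suc t)
  difference (tri< x<1+t _ _) = trans (cong₂ _-_ (qint-≥ (ℕP.m<n⇒m<1+n x<1+t)) (qint-≥ (ℕP.≤-pred x<1+t)))
                                      (cong (_-_ (+ 0)) (sym (q^-other (ℕP.>⇒≢ x<1+t))))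
  difference (tri≈ _ refl _)  = trans (cong₂ _-_ (qint-≥ (ℕP.≤-refl {suc t})) (qint-< (ℕP.n<1+n t)))
                                      (cong (_-_ (+ 0)) (sym (q^-self (suc t))))
  difference (tri> _ _ 1+t<x) = trans (cong₂ _-_ (qint-< 1+t<x) (qint-< (ℕP.m<n⇒m<1+n 1+t<x)))
                                      (cong (_-_ (+ 0)) (sym (q^-other (ℕP.<⇒≢ 1+t<x))))

∏1-q^ : List ℕ → Series
∏1-q^ = foldr (λ x f → (1-q^ x) ⋆ f) oneS

_⋆^_ : Series → ℕ → Series
f ⋆^ zero  = oneS
f ⋆^ suc m = f ⋆ (f ⋆^ m)

prodQ⋆[1-q]^length : ∀ xs → prodQ xs ⋆ ((1-q^ 1) ⋆^ length xs) ≗ ∏1-q^ xs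
prodQ⋆[1-q]^length []       = ⋆-identityˡ oneS
prodQ⋆[1-q]^length (x ∷ xs) = begin
  (qint x ⋆ prodQ xs) ⋆ ((1-q^ 1) ⋆ ((1-q^ 1) ⋆^ length xs))
    ≈⟨ interchange (qint x) (prodQ xs) (1-q^ 1) ((1-q^ 1) ⋆^ length xs) ⟩
  (qint x ⋆ (1-q^ 1)) ⋆ (prodQ xs ⋆ ((1-q^ 1) ⋆^ length xs))
    ≈⟨ ⋆-cong (≗-trans (⋆-comm (qint x) (1-q^ 1)) (1-q⋆qint x)) (prodQ⋆[1-q]^length xs) ⟩
  (1-q^ x) ⋆ ∏1-q^ xs ∎
  where open ≗-Reasoning

∏1-q^-0 : ∀ {xs} → All (0 <_) xs → ∏1-q^ xs 0 ≡ + 1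
∏1-q^-0 []                   = refl
∏1-q^-0 {suc x ∷ xs} (_ ∷ ps) = cong (λ z → + 0 + (+ 1 - + 0) * z) (∏1-q^-0 ps)

count-∷-≡ : ∀ x xs → count x (x ∷ xs) ≡ suc (count x xs)
count-∷-≡ x xs = cong length (filter-accept (ℕ._≟ x) refl)

count-∷-≢ : ∀ {i x} xs → i ≢ x → count i (x ∷ xs) ≡ count i xs
count-∷-≢ xs i≢x = cong length (filter-reject (ℕ._≟ _) (i≢x ∘ sym))

count-replicate-++-≡ : ∀ m x ν → count x (replicate m x ++ ν) ≡ m ℕ.+ count x ν
count-replicate-++-≡ zero    x ν = refl
count-replicate-++-≡ (suc m) x ν = trans (count-∷-≡ x (replicate m x ++ ν)) (cong suc (count-replicate-++-≡ m x ν))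

count-replicate-++-≢ : ∀ m {x i} ν → i ≢ x → count i (replicate m x ++ ν) ≡ count i ν
count-replicate-++-≢ zero    ν i≢x = refl
count-replicate-++-≢ (suc m) ν i≢x = trans (count-∷-≢ (replicate m _ ++ ν) i≢x) (count-replicate-++-≢ m ν i≢x)

count-absent : ∀ x {ν} → All (_< x) ν → count x ν ≡ 0
count-absent x []          = refl
count-absent x (y<x ∷ ν<x) = trans (count-∷-≢ _ (ℕP.>⇒≢ y<x)) (count-absent x ν<x)

Mult-∷ʳ-≡ : ∀ a b x → Mult a (x ∷ b) x ≡ Mult a b x + + 1
Mult-∷ʳ-≡ a b x = begin
  + count x (x ∷ b) - + count x a   ≡⟨ cong (λ n → + n - + count x a) (count-∷-≡ x b) ⟩
  + 1 + + count x b - + count x a   ≡⟨ shift (+ count x b) (+ count x a) ⟩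
  + count x b - + count x a + + 1   ∎
  where
  open ≡-Reasoning
  shift : ∀ m n → + 1 + m - n ≡ m - n + + 1
  shift = solve-∀

Mult-∷ˡ-≡ : ∀ a b x → Mult a b x ≡ Mult (x ∷ a) b x + + 1
Mult-∷ˡ-≡ a b x = begin
  + count x b - + count x a          ≡⟨ shift (+ count x b) (+ count x a) ⟩
  + count x b - (+ 1 + + count x a) + + 1  ≡⟨ cong (λ n → + count x b - + n + + 1) (count-∷-≡ x a) ⟨
  + count x b - + count x (x ∷ a) + + 1 ∎
  where
  open ≡-Reasoning
  shift : ∀ m n → m - n ≡ m - (+ 1 + n) + + 1
  shift = solve-∀

Mult-∷ʳ-≢ : ∀ a b {x i} → i ≢ x → Mult a (x ∷ b) i ≡ Mult a b i
Mult-∷ʳ-≢ a b {i = i} i≢x = cong (λ n → + n - + count i a) (count-∷-≢ b i≢x)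

Mult-∷ˡ-≢ : ∀ a b {x i} → i ≢ x → Mult a b i ≡ Mult (x ∷ a) b i
Mult-∷ˡ-≢ a b {i = i} i≢x = cong (λ n → + count i b - + n) (sym (count-∷-≢ a i≢x))

∏1-q^⋆productSeries : ∀ {a b} → All (0 <_) a → All (0 <_) b → ∏1-q^ b ⋆ productSeries (Mult a b) ≗ ∏1-q^ a
∏1-q^⋆productSeries {a} {suc x ∷ b} pa (_ ∷ pb) = begin
  ((1-q^ suc x) ⋆ ∏1-q^ b) ⋆ productSeries (Mult a (suc x ∷ b))
    ≈⟨ xy∙z≈y∙xz (1-q^ suc x) (∏1-q^ b) (productSeries (Mult a (suc x ∷ b))) ⟩
  ∏1-q^ b ⋆ ((1-q^ suc x) ⋆ productSeries (Mult a (suc x ∷ b)))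
    ≈⟨ ⋆-congˡ (∏1-q^ b) (1-q^⋆productSeries x (Mult-∷ʳ-≡ a b (suc x)) (Mult-∷ʳ-≢ a b)) ⟩
  ∏1-q^ b ⋆ productSeries (Mult a b)
    ≈⟨ ∏1-q^⋆productSeries pa pb ⟩
  ∏1-q^ a ∎
  where open ≗-Reasoning
∏1-q^⋆productSeries {suc x ∷ a} {[]} (_ ∷ pa) [] = begin
  oneS ⋆ productSeries (Mult (suc x ∷ a) [])
    ≈⟨ ⋆-identityˡ (productSeries (Mult (suc x ∷ a) [])) ⟩
  productSeries (Mult (suc x ∷ a) [])
    ≈⟨ 1-q^⋆productSeries x (Mult-∷ˡ-≡ a [] (suc x)) (Mult-∷ˡ-≢ a []) ⟨
  (1-q^ suc x) ⋆ productSeries (Mult a [])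
    ≈⟨ ⋆-congˡ (1-q^ suc x) (≗-trans (≗-sym (⋆-identityˡ (productSeries (Mult a [])))) (∏1-q^⋆productSeries pa [])) ⟩
  (1-q^ suc x) ⋆ ∏1-q^ a ∎
  where open ≗-Reasoning
∏1-q^⋆productSeries {[]} {[]} [] [] = ≗-trans (⋆-identityˡ (productSeries (Mult [] []))) productSeries-0

coefficients≡productSeries : ∀ a b → length a ≡ length b → All (0 <_) a → All (0 <_) b →
                             (c : Series) → c ⋆ prodQ b ≗ prodQ a → c ≗ productSeries (Mult a b)
coefficients≡productSeries a b |a|≡|b| pa pb c c⋆b≗a = ⋆-cancelʳ {c} {productSeries (Mult a b)} {∏1-q^ b} (∏1-q^-0 pb) (begin
  c ⋆ ∏1-q^ b                       ≈⟨ ⋆-congˡ c (prodQ⋆[1-q]^length b) ⟨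
  c ⋆ (prodQ b ⋆ (1-q ⋆^ length b)) ≈⟨ ⋆-assoc c (prodQ b) (1-q ⋆^ length b) ⟨
  (c ⋆ prodQ b) ⋆ (1-q ⋆^ length b) ≈⟨ ⋆-cong c⋆b≗a (λ n → cong (λ m → (1-q ⋆^ m) n) (sym |a|≡|b|)) ⟩
  prodQ a ⋆ (1-q ⋆^ length a)       ≈⟨ prodQ⋆[1-q]^length a ⟩
  ∏1-q^ a                           ≈⟨ ∏1-q^⋆productSeries pa pb ⟨
  ∏1-q^ b ⋆ productSeries (Mult a b) ≈⟨ ⋆-comm (∏1-q^ b) (productSeries (Mult a b)) ⟩
  productSeries (Mult a b) ⋆ ∏1-q^ b ∎)
  where
  open ≗-Reasoning
  1-q = 1-q^ 1

-- Partitions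

∈-concatMap⁻ : ∀ {A B : Set} (f : A → List B) {xs y} → y ∈ concatMap f xs → ∃[ x ] x ∈ xs × y ∈ f x
∈-concatMap⁻ f {xs} y∈ with ∈-concat⁻′ (map f xs) y∈
... | ys , y∈ys , ys∈ with ∈-map⁻ f ys∈
... | x , x∈xs , refl = x , x∈xs , y∈ys

∈-concatMap⁺ : ∀ {A B : Set} (f : A → List B) {xs x y} → x ∈ xs → y ∈ f x → y ∈ concatMap f xs
∈-concatMap⁺ f x∈xs y∈fx = ∈-concat⁺′ y∈fx (∈-map⁺ f x∈xs)

concatMap-unique : ∀ {A B : Set} (f : A → List B) {xs} → Unique xs → (∀ x → Unique (f x)) →
                   (∀ {x y} → x ≢ y → Disjoint (f x) (f y)) → Unique (concatMap f xs)
concatMap-unique f uxs uf disjoint =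
  Unique.concat⁺ (AllP.map⁺ (All.universal uf _)) (AllPairsP.map⁺ (AllPairs.map disjoint uxs))

Nonincreasing : List ℕ → Set
Nonincreasing μ = T (nonincreasingᵇ μ)

PartsIn : ℕ → List ℕ → Set
PartsIn j = All (λ y → 1 ℕ.≤ y × y ℕ.≤ j)

IsPartition : ℕ → ℕ → List ℕ → Set
IsPartition s j μ = Nonincreasing μ × PartsIn j μ × sumℕ μ ≡ s

Nonincreasing-tail : ∀ y μ → Nonincreasing (y ∷ μ) → Nonincreasing μ
Nonincreasing-tail y []      _  = _
Nonincreasing-tail y (z ∷ μ) ni = proj₂ (Equivalence.to T-∧ ni)

Nonincreasing⇒≤head : ∀ y μ → Nonincreasing (y ∷ μ) → All (ℕ._≤ y) μ
Nonincreasing⇒≤head y []      _  = []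
Nonincreasing⇒≤head y (z ∷ μ) ni with Equivalence.to T-∧ ni
... | z≤ᵇy , niz = z≤y ∷ All.map (λ w≤z → ℕP.≤-trans w≤z z≤y) (Nonincreasing⇒≤head z μ niz)
  where z≤y = ℕP.≤ᵇ⇒≤ z y z≤ᵇy

Nonincreasing-∷ : ∀ {x μ} → Nonincreasing μ → All (ℕ._≤ x) μ → Nonincreasing (x ∷ μ)
Nonincreasing-∷ {μ = []}    _  _         = _
Nonincreasing-∷ {μ = z ∷ μ} ni (z≤x ∷ _) = Equivalence.from T-∧ (ℕP.≤⇒≤ᵇ z≤x , ni)

Nonincreasing-replicate-++ : ∀ m {x ν} → Nonincreasing ν → All (ℕ._≤ x) ν → Nonincreasing (replicate m x ++ ν)
Nonincreasing-replicate-++ zero    ni ≤x = ni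
Nonincreasing-replicate-++ (suc m) ni ≤x =
  Nonincreasing-∷ (Nonincreasing-replicate-++ m ni ≤x) (AllP.++⁺ (AllP.replicate⁺ m ℕP.≤-refl) ≤x)

sum-replicate : ∀ m x → sumℕ (replicate m x) ≡ m ℕ.* x
sum-replicate zero    x = refl
sum-replicate (suc m) x = cong (x ℕ.+_) (sum-replicate m x)

PartsIn⇒< : ∀ {j ν} → PartsIn j ν → All (_< suc j) ν
PartsIn⇒< = All.map (ℕ.s≤s ∘ proj₂)

-- Mirrors the convolution in partialProduct: u is the total of the parts equal to 1+j.
boundedPartitions : ℕ → ℕ → List (List ℕ)
largestParts : ℕ → ℕ → ℕ → List (List ℕ)

boundedPartitions s       (suc j) = concatMap (largestParts s j) (upTo (suc s))
boundedPartitions zero    zero    = [] ∷ []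
boundedPartitions (suc s) zero    = []

largestParts s j u =
  if does (u ℕ.% suc j ℕ.≟ 0) then map (replicate (u ℕ./ suc j) (suc j) ++_) (boundedPartitions (s ∸ u) j) else []

largestParts-divisible : ∀ s j u → u ℕ.% suc j ≡ 0 →
                         largestParts s j u ≡ map (replicate (u ℕ./ suc j) (suc j) ++_) (boundedPartitions (s ∸ u) j)
largestParts-divisible s j u ∣u rewrite dec-true (u ℕ.% suc j ℕ.≟ 0) ∣u = refl

largestParts-indivisible : ∀ s j u → u ℕ.% suc j ≢ 0 → largestParts s j u ≡ []
largestParts-indivisible s j u ∤u rewrite dec-false (u ℕ.% suc j ℕ.≟ 0) ∤u = refl

∈-largestParts⁻ : ∀ s j u {μ} → μ ∈ largestParts s j u →
                  u ℕ.% suc j ≡ 0 × ∃[ ν ] ν ∈ boundedPartitions (s ∸ u) j × μ ≡ replicate (u ℕ./ suc j) (suc j) ++ ν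
∈-largestParts⁻ s j u {μ} μ∈ with u ℕ.% suc j ℕ.≟ 0
... | no ∤u = contradiction (subst (μ ∈_) (largestParts-indivisible s j u ∤u) μ∈) λ ()
... | yes ∣u with ∈-map⁻ (replicate (u ℕ./ suc j) (suc j) ++_) (subst (μ ∈_) (largestParts-divisible s j u ∣u) μ∈)
... | ν , ν∈ , μ≡ = ∣u , ν , ν∈ , μ≡

divisible⇒≡quotient*divisor : ∀ u x .{{_ : ℕ.NonZero x}} → u ℕ.% x ≡ 0 → u ≡ (u ℕ./ x) ℕ.* x
divisible⇒≡quotient*divisor u x ∣u = trans (ℕD.m≡m%n+[m/n]*n u x) (cong (ℕ._+ (u ℕ./ x) ℕ.* x) ∣u)

boundedPartitions-sound : ∀ s j {μ} → μ ∈ boundedPartitions s j → IsPartition s j μ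
boundedPartitions-sound zero zero (here refl) = _ , [] , refl
boundedPartitions-sound s (suc j) μ∈ with ∈-concatMap⁻ (largestParts s j) μ∈
... | u , u∈ , μ∈′ with ∈-largestParts⁻ s j u μ∈′
... | ∣u , ν , ν∈ , refl with boundedPartitions-sound (s ∸ u) j ν∈
... | niν , partsν , sumν =
  Nonincreasing-replicate-++ m niν (All.map (ℕP.m≤n⇒m≤1+n ∘ proj₂) partsν) ,
  AllP.++⁺ (AllP.replicate⁺ m (ℕ.z<s , ℕP.≤-refl)) (All.map (λ (1≤y , y≤j) → 1≤y , ℕP.m≤n⇒m≤1+n y≤j) partsν) ,
  (begin
    sumℕ (replicate m (suc j) ++ ν)      ≡⟨ sum-++ (replicate m (suc j)) ν ⟩
    sumℕ (replicate m (suc j)) ℕ.+ sumℕ ν ≡⟨ cong₂ ℕ._+_ (sum-replicate m (suc j)) sumν ⟩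
    m ℕ.* suc j ℕ.+ (s ∸ u)              ≡⟨ cong (ℕ._+ (s ∸ u)) (divisible⇒≡quotient*divisor u (suc j) ∣u) ⟨
    u ℕ.+ (s ∸ u)                        ≡⟨ ℕP.m+[n∸m]≡n (ℕP.≤-pred (∈-upTo⁻ u∈)) ⟩
    s                                    ∎)
  where
  open ≡-Reasoning
  m = u ℕ./ suc j

splitLargest : ∀ j {μ} → Nonincreasing μ → PartsIn (suc j) μ →
               ∃₂ λ m ν → μ ≡ replicate m (suc j) ++ ν × Nonincreasing ν × PartsIn j ν
splitLargest j {[]}    _  _ = 0 , [] , refl , _ , []
splitLargest j {y ∷ μ} ni ((1≤y , y≤1+j) ∷ parts) with y ℕ.≟ suc j
... | yes refl with splitLargest j (Nonincreasing-tail y μ ni) parts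
...   | m , ν , refl , niν , partsν = suc m , ν , refl , niν , partsν
splitLargest j {y ∷ μ} ni ((1≤y , y≤1+j) ∷ parts) | no y≢1+j =
  0 , y ∷ μ , refl , ni , (1≤y , y≤j) ∷ All.zipWith (λ ((1≤z , _) , z≤y) → 1≤z , ℕP.≤-trans z≤y y≤j)
                                                     (parts , Nonincreasing⇒≤head y μ ni)
  where y≤j = ℕP.≤-pred (ℕP.≤∧≢⇒< y≤1+j y≢1+j)

boundedPartitions-complete : ∀ s j {μ} → IsPartition s j μ → μ ∈ boundedPartitions s j
boundedPartitions-complete s zero {[]}    (_ , _ , refl)         = here refl
boundedPartitions-complete s zero {y ∷ μ} (_ , (1≤y , y≤0) ∷ _ , _) = contradiction (ℕP.≤-trans 1≤y y≤0) λ ()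
boundedPartitions-complete s (suc j) {μ} (ni , parts , sumμ) with splitLargest j ni parts
... | m , ν , refl , niν , partsν =
  ∈-concatMap⁺ (largestParts s j) (∈-upTo⁺ (ℕ.s≤s u≤s))
    (subst (replicate m (suc j) ++ ν ∈_) (sym (largestParts-divisible s j u (ℕD.m*n%n≡0 m (suc j))))
      (subst (λ q → replicate m (suc j) ++ ν ∈ map (replicate q (suc j) ++_) (boundedPartitions (s ∸ u) j))
             (sym (ℕD.m*n/n≡m m (suc j)))
             (∈-map⁺ (replicate m (suc j) ++_) ν∈)))
  where
  u = m ℕ.* suc j
  s≡u+Σν : s ≡ u ℕ.+ sumℕ ν
  s≡u+Σν = trans (sym sumμ) (trans (sum-++ (replicate m (suc j)) ν) (cong (ℕ._+ sumℕ ν) (sum-replicate m (suc j))))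
  u≤s : u ℕ.≤ s
  u≤s = subst (u ℕ.≤_) (sym s≡u+Σν) (ℕP.m≤m+n u (sumℕ ν))
  ν∈ : ν ∈ boundedPartitions (s ∸ u) j
  ν∈ = boundedPartitions-complete (s ∸ u) j
         (niν , partsν , sym (trans (cong (_∸ u) s≡u+Σν) (ℕP.m+n∸m≡n u (sumℕ ν))))

replicate-++-injective : ∀ m m′ {x ν ν′} → replicate m x ++ ν ≡ replicate m′ x ++ ν′ →
                         All (_< x) ν → All (_< x) ν′ → m ≡ m′
replicate-++-injective zero    zero     eq _          _          = refl
replicate-++-injective zero    (suc m′) eq (y<x ∷ _)  _          = contradiction (∷-injectiveˡ eq) (ℕP.<⇒≢ y<x)
replicate-++-injective (suc m) zero     eq _          (y<x ∷ _)  = contradiction (sym (∷-injectiveˡ eq)) (ℕP.<⇒≢ y<x)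
replicate-++-injective (suc m) (suc m′) eq ν<x        ν′<x       =
  cong suc (replicate-++-injective m m′ (∷-injectiveʳ eq) ν<x ν′<x)

boundedPartitions-unique : ∀ s j → Unique (boundedPartitions s j)
boundedPartitions-unique zero    zero    = [] ∷ []
boundedPartitions-unique (suc s) zero    = []
boundedPartitions-unique s       (suc j) = concatMap-unique (largestParts s j) (Unique.upTo⁺ (suc s)) unique disjoint
  where
  unique : ∀ u → Unique (largestParts s j u)
  unique u with u ℕ.% suc j ℕ.≟ 0
  ... | yes ∣u = subst Unique (sym (largestParts-divisible s j u ∣u))
                   (Unique.map⁺ (++-cancelˡ (replicate (u ℕ./ suc j) (suc j)) _ _) (boundedPartitions-unique (s ∸ u) j))
  ... | no ∤u  = subst Unique (sym (largestParts-indivisible s j u ∤u)) []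
  disjoint : ∀ {u u′} → u ≢ u′ → Disjoint (largestParts s j u) (largestParts s j u′)
  disjoint {u} {u′} u≢u′ (μ∈ , μ∈′) with ∈-largestParts⁻ s j u μ∈ | ∈-largestParts⁻ s j u′ μ∈′
  ... | ∣u , ν , ν∈ , μ≡ | ∣u′ , ν′ , ν′∈ , μ≡′ = u≢u′ (begin
    u                       ≡⟨ divisible⇒≡quotient*divisor u (suc j) ∣u ⟩
    u ℕ./ suc j ℕ.* suc j   ≡⟨ cong (ℕ._* suc j) sameCount ⟩
    u′ ℕ./ suc j ℕ.* suc j  ≡⟨ divisible⇒≡quotient*divisor u′ (suc j) ∣u′ ⟨
    u′                      ∎)
    where
    open ≡-Reasoning
    sameCount = replicate-++-injective _ _ (trans (sym μ≡) μ≡′)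
                  (PartsIn⇒< (proj₁ (proj₂ (boundedPartitions-sound _ j ν∈))))
                  (PartsIn⇒< (proj₁ (proj₂ (boundedPartitions-sound _ j ν′∈))))

∈-listsOf⁻ : ∀ k l {μ} → μ ∈ listsOf k l → PartsIn k μ × length μ ≡ l
∈-listsOf⁻ k zero    (here refl) = [] , refl
∈-listsOf⁻ k (suc l) μ∈ with ∈-concatMap⁻ (λ x → map (x ∷_) (listsOf k l)) {xs = applyUpTo suc k} μ∈
... | x , x∈ , μ∈′ with ∈-applyUpTo⁻ suc {n = k} x∈ | ∈-map⁻ (x ∷_) μ∈′
... | i , i<k , refl | ν , ν∈ , refl with ∈-listsOf⁻ k l ν∈
... | partsν , |ν|≡l = (ℕ.z<s , i<k) ∷ partsν , cong suc |ν|≡l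

∈-listsOf⁺ : ∀ k {μ} → PartsIn k μ → μ ∈ listsOf k (length μ)
∈-listsOf⁺ k {[]}        []                        = here refl
∈-listsOf⁺ k {suc y ∷ μ} ((_ , 1+y≤k) ∷ parts) =
  ∈-concatMap⁺ (λ x → map (x ∷_) (listsOf k (length μ))) (∈-applyUpTo⁺ suc 1+y≤k) (∈-map⁺ (suc y ∷_) (∈-listsOf⁺ k parts))

listsOf-unique : ∀ k l → Unique (listsOf k l)
listsOf-unique k zero    = [] ∷ []
listsOf-unique k (suc l) = concatMap-unique (λ x → map (x ∷_) (listsOf k l))
  (Unique.applyUpTo⁺₁ suc k λ i<j _ → ℕP.<⇒≢ i<j ∘ ℕP.suc-injective)
  (λ x → Unique.map⁺ ∷-injectiveʳ (listsOf-unique k l))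
  disjoint
  where
  disjoint : ∀ {x y} → x ≢ y → Disjoint (map (x ∷_) (listsOf k l)) (map (y ∷_) (listsOf k l))
  disjoint {x} {y} x≢y (μ∈ , μ∈′) with ∈-map⁻ (x ∷_) μ∈ | ∈-map⁻ (y ∷_) μ∈′
  ... | _ , _ , refl | _ , _ , x∷ν≡y∷ν′ = x≢y (∷-injectiveˡ x∷ν≡y∷ν′)

isPartition? : ∀ k μ → Dec (isPartitionᵇ k μ ≡ true)
isPartition? k μ = isPartitionᵇ k μ Bool.≟ true

partitions-unique : ∀ k → Unique (partitions k)
partitions-unique k = Unique.filter⁺ (isPartition? k)
  (concatMap-unique (listsOf k) (Unique.upTo⁺ (suc k)) (listsOf-unique k) disjoint)
  where
  disjoint : ∀ {l l′} → l ≢ l′ → Disjoint (listsOf k l) (listsOf k l′)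
  disjoint l≢l′ (μ∈ , μ∈′) = l≢l′ (trans (sym (proj₂ (∈-listsOf⁻ k _ μ∈))) (proj₂ (∈-listsOf⁻ k _ μ∈′)))

length≤sum : ∀ {k μ} → PartsIn k μ → length μ ℕ.≤ sumℕ μ
length≤sum []                 = ℕ.z≤n
length≤sum ((1≤y , _) ∷ parts) = ℕP.+-mono-≤ 1≤y (length≤sum parts)

∈-partitions⁻ : ∀ k {μ} → μ ∈ partitions k → IsPartition k k μ
∈-partitions⁻ k μ∈ with ∈-filter⁻ (isPartition? k) {xs = concatMap (listsOf k) (upTo (suc k))} μ∈
... | μ∈′ , isP with ∈-concatMap⁻ (listsOf k) {xs = upTo (suc k)} μ∈′ | Equivalence.to T-∧ (Equivalence.from T-≡ isP)
... | l , _ , μ∈″ | ni , Σμ≡ᵇk = ni , proj₁ (∈-listsOf⁻ k l μ∈″) , ℕP.≡ᵇ⇒≡ _ k Σμ≡ᵇk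

∈-partitions⁺ : ∀ k {μ} → IsPartition k k μ → μ ∈ partitions k
∈-partitions⁺ k {μ} (ni , parts , Σμ≡k) = ∈-filter⁺ (isPartition? k) {xs = concatMap (listsOf k) (upTo (suc k))}
  (∈-concatMap⁺ (listsOf k) (∈-upTo⁺ (ℕ.s≤s (subst (length μ ℕ.≤_) Σμ≡k (length≤sum parts)))) (∈-listsOf⁺ k parts))
  (Equivalence.to T-≡ (Equivalence.from T-∧ (ni , ℕP.≡⇒≡ᵇ _ k Σμ≡k)))

partitions↭boundedPartitions : ∀ k → partitions k ↭ boundedPartitions k k
partitions↭boundedPartitions k = ∼bag⇒↭ (unique∧set⇒bag (partitions-unique k) (boundedPartitions-unique k k)
  (mk⇔ (boundedPartitions-complete k k ∘ ∈-partitions⁻ k) (∈-partitions⁺ k ∘ boundedPartitions-sound k k)))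

-- Summing over partitions

sumListℤ-++ : ∀ xs ys → sumListℤ (xs ++ ys) ≡ sumListℤ xs + sumListℤ ys
sumListℤ-++ []       ys = sym (ℤP.+-identityˡ (sumListℤ ys))
sumListℤ-++ (x ∷ xs) ys = trans (cong (_+_ x) (sumListℤ-++ xs ys)) (sym (ℤP.+-assoc x _ _))

sumListℤ-concatMap : ∀ {A B : Set} (g : B → ℤ) (f : A → List B) xs →
                     sumListℤ (map g (concatMap f xs)) ≡ sumListℤ (map (λ x → sumListℤ (map g (f x))) xs)
sumListℤ-concatMap g f []       = refl
sumListℤ-concatMap g f (x ∷ xs) = begin
  sumListℤ (map g (f x ++ concatMap f xs))                 ≡⟨ cong sumListℤ (map-++ g (f x) (concatMap f xs)) ⟩
  sumListℤ (map g (f x) ++ map g (concatMap f xs))         ≡⟨ sumListℤ-++ (map g (f x)) _ ⟩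
  sumListℤ (map g (f x)) + sumListℤ (map g (concatMap f xs)) ≡⟨ cong (_+_ (sumListℤ (map g (f x)))) (sumListℤ-concatMap g f xs) ⟩
  sumListℤ (map (λ x → sumListℤ (map g (f x))) (x ∷ xs))   ∎
  where open ≡-Reasoning

sumListℤ-applyUpTo : ∀ n (f : ℕ → ℕ) (h : ℕ → ℤ) → sumListℤ (map h (applyUpTo f n)) ≡ Σℤ n (h ∘ f)
sumListℤ-applyUpTo zero    f h = refl
sumListℤ-applyUpTo (suc n) f h = trans (cong (_+_ (h (f 0))) (sumListℤ-applyUpTo n (f ∘ suc) h)) (sym (Σℤ-suc n (h ∘ f)))

sumListℤ-cong : ∀ {A : Set} {g g′ : A → ℤ} xs → (∀ {x} → x ∈ xs → g x ≡ g′ x) → sumListℤ (map g xs) ≡ sumListℤ (map g′ xs)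
sumListℤ-cong []       g≡g′ = refl
sumListℤ-cong (x ∷ xs) g≡g′ = cong₂ _+_ (g≡g′ (here refl)) (sumListℤ-cong xs (g≡g′ ∘ there))

sumListℤ-*ˡ : ∀ {A : Set} c (g : A → ℤ) xs → sumListℤ (map (λ x → c * g x) xs) ≡ c * sumListℤ (map g xs)
sumListℤ-*ˡ c g []       = sym (ℤP.*-zeroʳ c)
sumListℤ-*ˡ c g (x ∷ xs) = trans (cong (_+_ (c * g x)) (sumListℤ-*ˡ c g xs)) (sym (ℤP.*-distribˡ-+ c (g x) _))

sumListℤ-↭ : ∀ {xs ys} → xs ↭ ys → sumListℤ xs ≡ sumListℤ ys
sumListℤ-↭ p = foldr-commMonoid ℤ-+-0.setoid ℤ-+-0.isCommutativeMonoid (↭⇒↭ₛ p)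
  where module ℤ-+-0 = CommutativeMonoid ℤP.+-0-commutativeMonoid

sumListℤ-filter : ∀ {A : Set} {P : A → Set} (g : A → ℤ) (P? : U.Decidable P) xs → (∀ {x} → ¬ P x → g x ≡ + 0) →
                  sumListℤ (map g (filter P? xs)) ≡ sumListℤ (map g xs)
sumListℤ-filter g P? []       g≡0 = refl
sumListℤ-filter g P? (x ∷ xs) g≡0 with P? x
... | yes _  = cong (_+_ (g x)) (sumListℤ-filter g P? xs g≡0)
... | no ¬Px = trans (sumListℤ-filter g P? xs g≡0) (sym (trans (cong (_+ sumListℤ (map g xs)) (g≡0 ¬Px)) (ℤP.+-identityˡ (sumListℤ (map g xs)))))

prodListℤ-single : ∀ (f g : ℕ → ℤ) {x xs} → Unique xs → x ∈ xs → (∀ {i} → i ≢ x → f i ≡ g i) → g x ≡ + 1 →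
                   prodListℤ (map f xs) ≡ f x * prodListℤ (map g xs)
prodListℤ-single f g {x} {x ∷ xs} (x∉xs ∷ uxs) (here refl) f≡g gx≡1 = cong (f x *_) (begin
  prodListℤ (map f xs)          ≡⟨ prodListℤ-cong xs (λ i∈xs → f≡g (All.lookup x∉xs i∈xs ∘ sym)) ⟩
  prodListℤ (map g xs)          ≡⟨ ℤP.*-identityˡ (prodListℤ (map g xs)) ⟨
  + 1 * prodListℤ (map g xs)    ≡⟨ cong (_* prodListℤ (map g xs)) gx≡1 ⟨
  prodListℤ (map g (x ∷ xs))    ∎)
  where
  open ≡-Reasoning
  prodListℤ-cong : ∀ xs → (∀ {i} → i ∈ xs → f i ≡ g i) → prodListℤ (map f xs) ≡ prodListℤ (map g xs)
  prodListℤ-cong []       f≡g = refl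
  prodListℤ-cong (y ∷ ys) f≡g = cong₂ _*_ (f≡g (here refl)) (prodListℤ-cong ys (f≡g ∘ there))
prodListℤ-single f g {x} {y ∷ xs} (y∉xs ∷ uxs) (there x∈xs) f≡g gx≡1 = begin
  f y * prodListℤ (map f xs)            ≡⟨ cong₂ _*_ (f≡g (All.lookup y∉xs x∈xs)) (prodListℤ-single f g uxs x∈xs f≡g gx≡1) ⟩
  g y * (f x * prodListℤ (map g xs))    ≡⟨ swap (g y) (f x) _ ⟩
  f x * (g y * prodListℤ (map g xs))    ∎
  where
  open ≡-Reasoning
  swap : ∀ a b c → a * (b * c) ≡ b * (a * c)
  swap = solve-∀

prodListℤ-zero : ∀ (f : ℕ → ℤ) {xs} → Any (λ i → f i ≡ + 0) xs → prodListℤ (map f xs) ≡ + 0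
prodListℤ-zero f {x ∷ xs} (here fx≡0)  = trans (cong (_* prodListℤ (map f xs)) fx≡0) (ℤP.*-zeroˡ (prodListℤ (map f xs)))
prodListℤ-zero f {x ∷ xs} (there any0) = trans (cong (f x *_) (prodListℤ-zero f any0)) (ℤP.*-zeroʳ (f x))

partFactor : ℤ → ℕ → ℤ
partFactor y c = if 1 ℕ.≤ᵇ c then binomℤ (y + + c - + 1) c else + 1

partFactor≡multichoose : ∀ y c → partFactor y c ≡ multichoose y c
partFactor≡multichoose y zero    = sym (choose-0 (y + + 0 - + 1))
partFactor≡multichoose y (suc c) = binomℤ≡choose (y + + suc c - + 1) (suc c)

term-[] : ∀ M k → term M k [] ≡ + 1
term-[] M k = go (applyUpTo suc k)
  where
  go : ∀ xs → prodListℤ (map (λ i → partFactor (M i) 0) xs) ≡ + 1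
  go []       = refl
  go (x ∷ xs) = trans (cong (_*_ (+ 1)) (go xs)) refl

term-replicate-++ : ∀ M k {j} m {ν} → j < k → All (_< suc j) ν →
                    term M k (replicate m (suc j) ++ ν) ≡ multichoose (M (suc j)) m * term M k ν
term-replicate-++ M k {j} m {ν} j<k ν<x = begin
  term M k (replicate m x ++ ν)
    ≡⟨ prodListℤ-single (λ i → partFactor (M i) (count i (replicate m x ++ ν))) (λ i → partFactor (M i) (count i ν))
         (Unique.applyUpTo⁺₁ suc k λ i<j _ → ℕP.<⇒≢ i<j ∘ ℕP.suc-injective) (∈-applyUpTo⁺ suc j<k)
         (λ i≢x → cong (partFactor (M _)) (count-replicate-++-≢ m ν i≢x))
         (cong (partFactor (M x)) (count-absent x ν<x)) ⟩
  partFactor (M x) (count x (replicate m x ++ ν)) * term M k ν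
    ≡⟨ cong (λ c → partFactor (M x) c * term M k ν)
            (trans (count-replicate-++-≡ m x ν) (trans (cong (m ℕ.+_) (count-absent x ν<x)) (ℕP.+-identityʳ m))) ⟩
  partFactor (M x) m * term M k ν
    ≡⟨ cong (_* term M k ν) (partFactor≡multichoose (M x) m) ⟩
  multichoose (M x) m * term M k ν ∎
  where
  open ≡-Reasoning
  x = suc j

Σterm-largestParts : ∀ M k {j} s u → j < k →
                     sumListℤ (map (term M k) (boundedPartitions (s ∸ u) j)) ≡ partialProduct M j (s ∸ u) →
                     sumListℤ (map (term M k) (largestParts s j u)) ≡ negBinomial j (M (suc j)) u * partialProduct M j (s ∸ u)
Σterm-largestParts M k {j} s u j<k Σterm≡ with u ℕ.% suc j ℕ.≟ 0
... | no ∤u = begin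
  sumListℤ (map (term M k) (largestParts s j u))
    ≡⟨ cong (sumListℤ ∘ map (term M k)) (largestParts-indivisible s j u ∤u) ⟩
  + 0
    ≡⟨ ℤP.*-zeroˡ (partialProduct M j (s ∸ u)) ⟨
  + 0 * partialProduct M j (s ∸ u)
    ≡⟨ cong (_* partialProduct M j (s ∸ u)) (negBinomial-indivisible j (M (suc j)) u ∤u) ⟨
  negBinomial j (M (suc j)) u * partialProduct M j (s ∸ u) ∎
  where open ≡-Reasoning
... | yes ∣u = begin
  sumListℤ (map (term M k) (largestParts s j u))
    ≡⟨ cong (sumListℤ ∘ map (term M k)) (largestParts-divisible s j u ∣u) ⟩
  sumListℤ (map (term M k) (map (replicate m x ++_) νs))
    ≡⟨ cong sumListℤ (map-∘ νs) ⟨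
  sumListℤ (map (term M k ∘ (replicate m x ++_)) νs)
    ≡⟨ sumListℤ-cong νs (λ ν∈ → term-replicate-++ M k m j<k (PartsIn⇒< (proj₁ (proj₂ (boundedPartitions-sound _ j ν∈))))) ⟩
  sumListℤ (map (λ ν → multichoose (M x) m * term M k ν) νs)
    ≡⟨ sumListℤ-*ˡ (multichoose (M x) m) (term M k) νs ⟩
  multichoose (M x) m * sumListℤ (map (term M k) νs)
    ≡⟨ cong₂ _*_ (negBinomial-divisible j (M x) u ∣u) (sym Σterm≡) ⟨
  negBinomial j (M x) u * partialProduct M j (s ∸ u) ∎
  where
  open ≡-Reasoning
  x = suc j
  m = u ℕ./ x
  νs = boundedPartitions (s ∸ u) j

Σterm≡partialProduct : ∀ M k j s → j ℕ.≤ k → sumListℤ (map (term M k) (boundedPartitions s j)) ≡ partialProduct M j s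
Σterm≡partialProduct M k zero    zero    _   = cong (_+ + 0) (term-[] M k)
Σterm≡partialProduct M k zero    (suc s) _   = refl
Σterm≡partialProduct M k (suc j) s       j<k = begin
  sumListℤ (map (term M k) (concatMap (largestParts s j) (upTo (suc s))))
    ≡⟨ sumListℤ-concatMap (term M k) (largestParts s j) (upTo (suc s)) ⟩
  sumListℤ (map (λ u → sumListℤ (map (term M k) (largestParts s j u))) (upTo (suc s)))
    ≡⟨ sumListℤ-applyUpTo (suc s) id _ ⟩
  Σℤ (suc s) (λ u → sumListℤ (map (term M k) (largestParts s j u)))
    ≡⟨ Σℤ-cong (suc s) (λ {u} _ → Σterm-largestParts M k s u j<k (Σterm≡partialProduct M k j (s ∸ u) (ℕP.<⇒≤ j<k))) ⟩
  partialProduct M (suc j) s ∎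
  where open ≡-Reasoning

fullSum≡productSeries : ∀ M k → fullSum M k ≡ productSeries M k
fullSum≡productSeries M k = trans (sumListℤ-↭ (↭-map⁺ (term M k) (partitions↭boundedPartitions k)))
                                  (Σterm≡partialProduct M k k k ℕP.≤-refl)

multichoose-inadmissible : ∀ y c → ¬ T (does (+ 0 ℤ.<? y) ∨ (c ℕ.≤ᵇ ∣ y ∣)) → multichoose y c ≡ + 0
multichoose-inadmissible y c inadmissible = vanishes y (admissible ∘ inj₁ ∘ Equivalence.from T-≡ ∘ dec-true (+ 0 ℤ.<? y)) (admissible ∘ inj₂ ∘ ℕP.≤⇒≤ᵇ)
  where
  admissible = inadmissible ∘ Equivalence.from (T-∨ {does (+ 0 ℤ.<? y)} {c ℕ.≤ᵇ ∣ y ∣})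
  vanishes : ∀ y → ¬ (+ 0 ℤ.< y) → ¬ (c ℕ.≤ ∣ y ∣) → multichoose y c ≡ + 0
  vanishes (+ zero)  _  c≰∣y∣ = multichoose-vanishes 0 c (ℕP.≰⇒> c≰∣y∣)
  vanishes (+ suc n) y≤0 _    = contradiction (ℤ.+<+ ℕ.z<s) y≤0
  vanishes -[1+ n ]  _  c≰∣y∣ = multichoose-vanishes (suc n) c (ℕP.≰⇒> c≰∣y∣)

term-inadmissible : ∀ M k μ → admissibleᵇ M k μ ≢ true → term M k μ ≡ + 0
term-inadmissible M k μ inadmissible = prodListℤ-zero (λ i → partFactor (M i) (count i μ))
  (Any.map (λ {i} ¬ok → trans (partFactor≡multichoose (M i) (count i μ)) (multichoose-inadmissible (M i) (count i μ) ¬ok))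
           (AllP.¬All⇒Any¬ (T? ∘ ok) (applyUpTo suc k) (inadmissible ∘ Equivalence.to T-≡ ∘ AllP.all⁻ ok)))
  where
  ok : ℕ → Bool.Bool
  ok i = does (+ 0 ℤ.<? M i) ∨ (count i μ ℕ.≤ᵇ ∣ M i ∣)

restrictedSum≡fullSum : ∀ M k → restrictedSum M k ≡ fullSum M k
restrictedSum≡fullSum M k =
  sumListℤ-filter (term M k) (λ μ → admissibleᵇ M k μ Bool.≟ true) (partitions k) (λ {μ} → term-inadmissible M k μ)

lemma3p2 : (a b : List ℕ) → length a ≡ length b →
           All (0 <_) a → All (0 <_) b →
           (c : Series) → (∀ n → (c ⋆ prodQ b) n ≡ prodQ a n) →
           ∀ k → (c k ≡ fullSum (Mult a b) k)
               × (c k ≡ restrictedSum (Mult a b) k)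
lemma3p2 a b |a|≡|b| pa pb c c⋆b≗a k = c≡fullSum , trans c≡fullSum (sym (restrictedSum≡fullSum (Mult a b) k))
  where
  c≡fullSum : c k ≡ fullSum (Mult a b) k
  c≡fullSum = trans (coefficients≡productSeries a b |a|≡|b| pa pb c c⋆b≗a k) (sym (fullSum≡productSeries (Mult a b) k))
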